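{- For every $n\ge0$, the number $d(n)=|\{\mathbf a(\pi)+\mathbf b(\pi):\pi\in\mathcal D(n)\}|$ of distinct values of area plus bounce over Dyck paths of semilength $n$ (equivalently, the number of terms of $\sum_{\pi\in\mathcal D(n)}q^{\mathbf a(\pi)+\mathbf b(\pi)}$) equals the number of nonzero coefficients of the polynomial $B_n(q)$.
   Context: A Dyck path of semilength $n$ is a lattice path from $(0,0)$ to $(n,n)$ with unit north and east steps never going below $y=x$; $\mathcal D(n)$ is their set. The area $\mathbf a(\pi)$ is the number of whole unit cells between $\pi$ and the diagonal. With $h_i$ the $y$-coordinate of the east step of $\pi$ in column $i$ (strip $i-1\le x\le i$), the bounce points are $b_0=0$, $b_k=h_{b_{k-1}+1}$ until $b_m=n$, and the bounce is $\mathbf b(\pi)=\sum_{k=1}^m(n-b_k)$. Johnson's $q$-Bell polynomials are defined by $B_0(q)=1$ and $B_n(q)=\sum_{k=0}^{n-1}\binom{n-1}{k}_q B_k(q)$ for $n\ge1$, where $\binom{n}{k}_q$ is the Gaussian ($q$-binomial) coefficient. -}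

module Defs where

open import Data.Nat using (ℕ; zero; suc; _+_; _*_; _∸_; _≟_)
open import Data.Bool using (Bool; true; false; _∧_)
open import Data.List using (List; []; _∷_; length; map; foldr; replicate; _++_)
open import Data.Vec using (Vec; _∷ʳ_; lookup; toList; tabulate)
  renaming ([] to []ᵥ; _∷_ to _∷ᵥ_)
open import Data.Fin using (Fin; toℕ; fromℕ)
open import Data.Product using (Σ; _×_; _,_)
open import Relation.Nullary using (yes; no)
open import Relation.Binary.PropositionalEquality using (_≡_)

-- Lattice paths: N = north (up) unit step, E = east (right) unit step.

data Step : Set where
  N E : Step

countN : List Step → ℕ
countN []      = 0
countN (N ∷ s) = suc (countN s)
countN (E ∷ s) = countN s

countE : List Step → ℕ
countE []      = 0
countE (N ∷ s) = countE s
countE (E ∷ s) = suc (countE s)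

-- neverBelow d s : starting at a point with (y - x) = d, the path s never
-- goes strictly below the diagonal y = x.
neverBelow : ℕ → List Step → Bool
neverBelow d       []      = true
neverBelow d       (N ∷ s) = neverBelow (suc d) s
neverBelow zero    (E ∷ s) = false
neverBelow (suc d) (E ∷ s) = neverBelow d s

IsDyck : ℕ → List Step → Set
IsDyck n s = (countN s ≡ n) × (countE s ≡ n) × (neverBelow 0 s ≡ true)

Dyck : ℕ → Set
Dyck n = Σ (List Step) (IsDyck n)

-- heights y s : list [h_1, h_2, …] of y-coordinates of the east steps,
-- in order of columns (column i is the strip i-1 ≤ x ≤ i), starting at height y.
heightsFrom : ℕ → List Step → List ℕ
heightsFrom y []      = []
heightsFrom y (N ∷ s) = heightsFrom (suc y) s
heightsFrom y (E ∷ s) = y ∷ heightsFrom y s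

heights : List Step → List ℕ
heights = heightsFrom 0

-- Area: Σ_i (h_i - i), columns indexed from 1
-- (column i contains exactly h_i - i whole cells between path and diagonal).
areaFrom : ℕ → List ℕ → ℕ
areaFrom i []       = 0
areaFrom i (h ∷ hs) = (h ∸ i) + areaFrom (suc i) hs

area : {n : ℕ} → Dyck n → ℕ
area (s , _) = areaFrom 1 (heights s)

-- h_i (1-indexed) from the list of heights; default 0 out of range.
hAt : List ℕ → ℕ → ℕ
hAt []       _             = 0
hAt (h ∷ hs) zero          = 0
hAt (h ∷ hs) (suc zero)    = h
hAt (h ∷ hs) (suc (suc i)) = hAt hs (suc i)

-- Bounce: b_0 = 0, b_k = h_{b_{k-1}+1} until b_m = n; bounce = Σ_{k=1}^m (n - b_k).
-- The fuel argument bounds the number of bounce steps (b_k is strictly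
-- increasing on Dyck paths, so n steps suffice).
bounceFrom : (fuel n b : ℕ) → List ℕ → ℕ
bounceFrom zero       n b hs = 0
bounceFrom (suc fuel) n b hs with b ≟ n
... | yes _ = 0
... | no  _ = (n ∸ hAt hs (suc b)) + bounceFrom fuel n (hAt hs (suc b)) hs

bounce : {n : ℕ} → Dyck n → ℕ
bounce {n} (s , _) = bounceFrom n n 0 (heights s)

-- Polynomials in q with natural-number coefficients, as coefficient lists
-- (constant term first).

Poly : Set
Poly = List ℕ

infixl 6 _⊕_
infixl 7 _⊗_

_⊕_ : Poly → Poly → Poly
[]       ⊕ q        = q
(a ∷ p)  ⊕ []       = a ∷ p
(a ∷ p)  ⊕ (b ∷ q)  = (a + b) ∷ (p ⊕ q)

_⊗_ : Poly → Poly → Poly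
[]      ⊗ q = []
(a ∷ p) ⊗ q = map (a *_) q ⊕ (0 ∷ (p ⊗ q))

shift : ℕ → Poly → Poly
shift k p = replicate k 0 ++ p

-- Gaussian binomial coefficient [n choose k]_q via q-Pascal:
-- [n+1 choose k+1]_q = [n choose k]_q + q^(k+1) [n choose k+1]_q.
qbinom : ℕ → ℕ → Poly
qbinom zero    zero    = 1 ∷ []
qbinom zero    (suc k) = []
qbinom (suc n) zero    = 1 ∷ []
qbinom (suc n) (suc k) = qbinom n k ⊕ shift (suc k) (qbinom n (suc k))

psum : List Poly → Poly
psum = foldr _⊕_ []

-- Table (B_0(q), …, B_n(q)) of Johnson's q-Bell polynomials:
-- B_0 = 1, B_{n+1} = Σ_{k=0}^{n} [n choose k]_q B_k.
bellTable : (n : ℕ) → Vec Poly (suc n)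
bellTable zero    = (1 ∷ []) ∷ᵥ []ᵥ
bellTable (suc n) =
  bellTable n ∷ʳ psum (toList (tabulate (λ (k : Fin (suc n)) →
                         qbinom n (toℕ k) ⊗ lookup (bellTable n) k)))

qBell : ℕ → Poly
qBell n = lookup (bellTable n) (fromℕ n)

nonzeroCoeffs : Poly → ℕ
nonzeroCoeffs []            = 0
nonzeroCoeffs (zero  ∷ p)   = nonzeroCoeffs p
nonzeroCoeffs (suc _ ∷ p)   = suc (nonzeroCoeffs p)

{-# OPTIONS --safe #-}
-- Let D n be the number of nonzero coefficients of B_n(q). All coefficients are nonnegative and [n, k]_q has
-- nonzero coefficients exactly in degrees 0, …, k (n - k), so by Johnson's recurrence the nonzero coefficients
-- of B_(n+1) are exactly those of degree below D (n + 1) = max over k ≤ n of k (n - k) + D k.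
-- Record a Dyck path by its column heights h_i and put w = Σ h_i + bounce = area + bounce + (1 + ⋯ + n).
-- Cutting the path at its first bounce point a = c + 1 (so n = a + k) leaves the c columns 2, …, a, with
-- heights in [a, n], and a Dyck path of semilength k translated by (a, a). Hence n² - w is the total deficit
-- of those columns below n (at most c k) plus n² - w of the smaller path, so by induction the gap n² - w is
-- always below D n. Conversely, for the maximising k every gap below D n occurs: a gap below c k comes from
-- the columns alone (smaller path as high as possible), and a larger one from the lowest columns together
-- with a smaller path. So area + bounce takes exactly D n consecutive values.
module Submission where

open import Defs
open import Data.Nat using (ℕ; _+_)
open import Data.List using (List; length)
open import Data.List.Membership.Propositional using (_∈_)
open import Data.List.Relation.Unary.Unique.Propositional using (Unique)
open import Data.Product using (Σ; _×_; ∃-syntax)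
open import Function.Bundles using (_⇔_)
open import Relation.Binary.PropositionalEquality using (_≡_)
open import Data.Bool using (true)
open import Data.Nat using (zero; suc; _*_; _∸_; _≤_; _<_; _⊔_; _⊓_; z≤n; s≤s; >-nonZero)
open import Data.Nat.Properties
open import Data.Nat.ListAction using (sum)
open import Data.Nat.ListAction.Properties using (sum-++)
open import Data.Nat.Induction using (<-rec)
open import Data.Nat.Tactic.RingSolver using (solve-∀)
open import Data.Fin using (Fin; zero; suc; toℕ; fromℕ; fromℕ<; inject₁; lower₁)
open import Data.Fin.Properties using (toℕ-fromℕ; toℕ-fromℕ<; toℕ<n; toℕ-inject₁; toℕ-injective; inject₁-lower₁)
open import Data.List using ([]; _∷_; map; replicate; _++_)
open import Data.List.Properties using (length-replicate; map-replicate; ++-identityʳ; length-tabulate)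
open import Data.List.Relation.Unary.All as All using (All; []; _∷_)
open import Data.List.Membership.Propositional.Properties using (∈-tabulate⁺; ∈-tabulate⁻)
open import Data.List.Relation.Unary.Unique.Propositional.Properties using (tabulate⁺)
open import Data.Vec using (Vec; _∷ʳ_; lookup; toList; tabulate) renaming ([] to []ᵥ; _∷_ to _∷ᵥ_)
open import Data.Vec.Properties using (tabulate-cong)
open import Data.Product using (_,_; proj₁; proj₂)
open import Data.Sum using (_⊎_; inj₁; inj₂)
open import Data.Empty using (⊥-elim)
import Data.List as List
open import Function using (_∘_)
open import Function.Bundles using (mk⇔)
open import Relation.Nullary using (yes; no)
open import Relation.Binary.PropositionalEquality

data FullSupport : ℕ → Poly → Set where
  []    : FullSupport 0 []
  0∷_   : ∀ {p} → FullSupport 0 p → FullSupport 0 (0 ∷ p)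
  suc∷_ : ∀ {d x p} → FullSupport d p → FullSupport (suc d) (suc x ∷ p)

full-cast : ∀ {d e p} → d ≡ e → FullSupport d p → FullSupport e p
full-cast refl f = f

nonzeroCoeffs-full : ∀ {d p} → FullSupport d p → nonzeroCoeffs p ≡ d
nonzeroCoeffs-full []       = refl
nonzeroCoeffs-full (0∷ f)   = nonzeroCoeffs-full f
nonzeroCoeffs-full (suc∷ f) = cong suc (nonzeroCoeffs-full f)

full-⊕ : ∀ {d e p q} → FullSupport d p → FullSupport e q → FullSupport (d ⊔ e) (p ⊕ q)
full-⊕ []               g        = g
full-⊕ (0∷ f)           []       = 0∷ f
full-⊕ (suc∷ f)         []       = suc∷ f
full-⊕ (0∷ f)           (0∷ g)   = 0∷ full-⊕ f g
full-⊕ (0∷ f)           (suc∷ g) = suc∷ full-⊕ f g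
full-⊕ {suc d} (suc∷ f) (0∷ g)   = suc∷ full-cast (⊔-identityʳ d) (full-⊕ f g)
full-⊕ (suc∷ f)         (suc∷ g) = suc∷ full-⊕ f g

zero-scale : ∀ q → FullSupport 0 (map (0 *_) q)
zero-scale []      = []
zero-scale (_ ∷ q) = 0∷ zero-scale q

full-scale : ∀ x {e q} → FullSupport e q → FullSupport e (map (suc x *_) q)
full-scale x []                = []
full-scale x {q = _ ∷ q} (0∷ f) =
  subst (λ c → FullSupport 0 (c ∷ map (suc x *_) q)) (sym (*-zeroʳ (suc x))) (0∷ full-scale x f)
full-scale x (suc∷ f)          = suc∷ full-scale x f

zero-⊗ : ∀ {p} q → FullSupport 0 p → FullSupport 0 (p ⊗ q)
zero-⊗ q []     = []
zero-⊗ q (0∷ f) = full-⊕ (zero-scale q) (0∷ zero-⊗ q f)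

full-⊗ : ∀ {d e p q} → FullSupport (suc d) p → FullSupport e q → 0 < e → FullSupport (d + e) (p ⊗ q)
full-⊗ {zero}  {q = q} (suc∷_ {x = x} f) g        (s≤s z≤n) = full-⊕ (full-scale x g) (0∷ zero-⊗ q f)
full-⊗ {suc d} {suc e} (suc∷_ {x = x} f) (suc∷ g) (s≤s z≤n) =
  suc∷ full-cast (m≤n⇒m⊔n≡n (≤-trans (n≤1+n e) (m≤n+m (suc e) d)))
              (full-⊕ (full-scale x g) (full-⊗ f (suc∷ g) (s≤s z≤n)))

zero-shift : ∀ j {q} → FullSupport 0 q → FullSupport 0 (shift j q)
zero-shift zero    f = f
zero-shift (suc j) f = 0∷ zero-shift j f

full-shift : ∀ j {d e p q} → j ≤ d → FullSupport d p → FullSupport e q →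
             FullSupport (d ⊔ (j + e)) (p ⊕ shift j q)
full-shift zero    _         f        g = full-⊕ f g
full-shift (suc j) (s≤s j≤d) (suc∷ f) g = suc∷ full-shift j j≤d f g

qbinom-above : ∀ {n k} → n < k → FullSupport 0 (qbinom n k)
qbinom-above {zero}  {suc k} _         = []
qbinom-above {suc n} {suc k} (s≤s n<k) =
  full-⊕ (qbinom-above n<k) (zero-shift (suc k) (qbinom-above (m<n⇒m<1+n n<k)))

qbinom-top : ∀ k m → suc k + suc (suc k * m) ≡ suc (suc k * suc m)
qbinom-top = solve-∀

qbinom-full′ : ∀ k m → FullSupport (suc (k * m)) (qbinom (k + m) k)
qbinom-full′ zero    zero    = suc∷ []
qbinom-full′ zero    (suc m) = suc∷ []
qbinom-full′ (suc k) zero    =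
  full-⊕ (qbinom-full′ k zero) (zero-shift (suc k) (qbinom-above (s≤s (≤-reflexive (+-identityʳ k)))))
qbinom-full′ (suc k) (suc m) =
  full-cast width (full-shift (suc k) (s≤s (m≤m*n k (suc m))) (qbinom-full′ k (suc m)) upper)
  where
  upper : FullSupport (suc (suc k * m)) (qbinom (k + suc m) (suc k))
  upper = subst (λ t → FullSupport (suc (suc k * m)) (qbinom t (suc k))) (sym (+-suc k m))
                (qbinom-full′ (suc k) m)
  width : suc (k * suc m) ⊔ (suc k + suc (suc k * m)) ≡ suc (suc k * suc m)
  width = trans (m≤n⇒m⊔n≡n (≤-trans (s≤s (*-monoˡ-≤ (suc m) (n≤1+n k)))
                                    (≤-reflexive (sym (qbinom-top k m)))))
                (qbinom-top k m)

qbinom-full : ∀ {n k} → k ≤ n → FullSupport (suc (k * (n ∸ k))) (qbinom n k)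
qbinom-full {n} {k} k≤n =
  subst (λ t → FullSupport (suc (k * (n ∸ k))) (qbinom t k)) (m+[n∸m]≡n k≤n) (qbinom-full′ k (n ∸ k))

lookup-∷ʳ-last : ∀ {A : Set} {m} (xs : Vec A m) y → lookup (xs ∷ʳ y) (fromℕ m) ≡ y
lookup-∷ʳ-last []ᵥ       y = refl
lookup-∷ʳ-last (_ ∷ᵥ xs) y = lookup-∷ʳ-last xs y

lookup-∷ʳ-inject₁ : ∀ {A : Set} {m} (xs : Vec A m) y (i : Fin m) → lookup (xs ∷ʳ y) (inject₁ i) ≡ lookup xs i
lookup-∷ʳ-inject₁ (_ ∷ᵥ xs) y zero    = refl
lookup-∷ʳ-inject₁ (_ ∷ᵥ xs) y (suc i) = lookup-∷ʳ-inject₁ xs y i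

fromℕ-or-inject₁ : ∀ {m} (i : Fin (suc m)) → i ≡ fromℕ m ⊎ ∃[ j ] i ≡ inject₁ j
fromℕ-or-inject₁ {m} i with m ≟ toℕ i
... | yes m≡i = inj₁ (toℕ-injective (trans (sym m≡i) (sym (toℕ-fromℕ m))))
... | no  m≢i = inj₂ (lower₁ i m≢i , sym (inject₁-lower₁ i m≢i))

lookup-bellTable : ∀ n (i : Fin (suc n)) → lookup (bellTable n) i ≡ qBell (toℕ i)
lookup-bellTable n i with fromℕ-or-inject₁ i
... | inj₁ refl = cong qBell (sym (toℕ-fromℕ n))
lookup-bellTable (suc n) i | inj₂ (j , refl) = begin
  lookup (bellTable n ∷ʳ _) (inject₁ j)  ≡⟨ lookup-∷ʳ-inject₁ (bellTable n) _ j ⟩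
  lookup (bellTable n) j                 ≡⟨ lookup-bellTable n j ⟩
  qBell (toℕ j)                          ≡⟨ cong qBell (sym (toℕ-inject₁ j)) ⟩
  qBell (toℕ (inject₁ j))                ∎
  where open ≡-Reasoning

qBell-suc : ∀ n →
  qBell (suc n) ≡ psum (toList (tabulate λ (i : Fin (suc n)) → qbinom n (toℕ i) ⊗ qBell (toℕ i)))
qBell-suc n = trans (lookup-∷ʳ-last (bellTable n) _)
  (cong (psum ∘ toList) (tabulate-cong λ i → cong (qbinom n (toℕ i) ⊗_) (lookup-bellTable n i)))

maxOver : ∀ m → (Fin m → ℕ) → ℕ
maxOver zero    g = 0
maxOver (suc m) g = g zero ⊔ maxOver m (g ∘ suc)

≤-maxOver : ∀ {m} g (i : Fin m) → g i ≤ maxOver m g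
≤-maxOver g zero    = m≤m⊔n _ _
≤-maxOver g (suc i) = ≤-trans (≤-maxOver (g ∘ suc) i) (m≤n⊔m _ _)

maxOver-attained : ∀ m g → ∃[ i ] maxOver (suc m) g ≡ g i
maxOver-attained zero    g = zero , ⊔-identityʳ (g zero)
maxOver-attained (suc m) g with ⊔-sel (g zero) (maxOver (suc m) (g ∘ suc))
... | inj₁ max≡g0 = zero , max≡g0
... | inj₂ max≡rest with maxOver-attained m (g ∘ suc)
...   | i , rest≡gi = suc i , trans max≡rest rest≡gi

psum-full : ∀ {m} (f : Fin m → Poly) (g : Fin m → ℕ) → (∀ i → FullSupport (g i) (f i)) →
            FullSupport (maxOver m g) (psum (toList (tabulate f)))
psum-full {zero}  f g full = []
psum-full {suc m} f g full = full-⊕ (full zero) (psum-full (f ∘ suc) (g ∘ suc) (full ∘ suc))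

D : ℕ → ℕ
D n = nonzeroCoeffs (qBell n)

termWidth : ℕ → ℕ → ℕ
termWidth n k = k * (n ∸ k) + D k

qBell-suc-full : ∀ n → (∀ {k} → k ≤ n → FullSupport (D k) (qBell k) × 0 < D k) →
                 FullSupport (maxOver (suc n) (termWidth n ∘ toℕ)) (qBell (suc n))
qBell-suc-full n below = subst (FullSupport _) (sym (qBell-suc n)) (psum-full _ _ term)
  where
  term : ∀ (i : Fin (suc n)) → FullSupport (termWidth n (toℕ i)) (qbinom n (toℕ i) ⊗ qBell (toℕ i))
  term i = full-⊗ (qbinom-full i≤n) (proj₁ (below i≤n)) (proj₂ (below i≤n))
    where i≤n = ≤-pred (toℕ<n i)

qBell-full : ∀ n → FullSupport (D n) (qBell n) × 0 < D n
qBell-full = <-rec (λ n → FullSupport (D n) (qBell n) × 0 < D n) step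
  where
  step : ∀ n → (∀ {k} → k < n → FullSupport (D k) (qBell k) × 0 < D k) →
         FullSupport (D n) (qBell n) × 0 < D n
  step zero    _   = suc∷ [] , s≤s z≤n
  step (suc n) rec =
    -- the term k = 0 has width D 0 = 1
    full-cast (sym width) full ,
    ≤-trans (≤-maxOver {suc n} (termWidth n ∘ toℕ) zero) (≤-reflexive (sym width))
    where
    full = qBell-suc-full n (λ k≤n → rec (s≤s k≤n))
    width : D (suc n) ≡ maxOver (suc n) (termWidth n ∘ toℕ)
    width = nonzeroCoeffs-full full

D-pos : ∀ n → 0 < D n
D-pos n = proj₂ (qBell-full n)

D-suc : ∀ n → D (suc n) ≡ maxOver (suc n) (termWidth n ∘ toℕ)
D-suc n = nonzeroCoeffs-full (qBell-suc-full n (λ {k} _ → qBell-full k))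

D-suc-≥ : ∀ c k → c * k + D k ≤ D (suc (c + k))
D-suc-≥ c k = begin
  c * k + D k                                      ≡⟨ cong (_+ D k) (*-comm c k) ⟩
  k * c + D k                                      ≡⟨ cong (λ t → k * t + D k) (sym (m+n∸n≡m c k)) ⟩
  termWidth (c + k) k                              ≡⟨ cong (termWidth (c + k)) (sym (toℕ-fromℕ< k<)) ⟩
  termWidth (c + k) (toℕ i)                        ≤⟨ ≤-maxOver (termWidth (c + k) ∘ toℕ) i ⟩
  maxOver (suc (c + k)) (termWidth (c + k) ∘ toℕ)  ≡⟨ sym (D-suc (c + k)) ⟩
  D (suc (c + k))                                  ∎
  where
  open ≤-Reasoning
  k< : k < suc (c + k)
  k< = s≤s (m≤n+m k c)
  i : Fin (suc (c + k))
  i = fromℕ< k<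

D-suc-attained : ∀ m → ∃[ c ] ∃[ k ] c + k ≡ m × D (suc m) ≡ c * k + D k
D-suc-attained m with maxOver-attained m (termWidth m ∘ toℕ)
... | i , max≡ = m ∸ toℕ i , toℕ i , m∸n+n≡m (≤-pred (toℕ<n i)) ,
  trans (D-suc m) (trans max≡ (cong (_+ D (toℕ i)) (*-comm (toℕ i) (m ∸ toℕ i))))

-- Heights n x y hs: hs lists the heights of the east steps of a path from (x, y) to (n, n)
-- that never goes below the diagonal.
data Heights (n : ℕ) : ℕ → ℕ → List ℕ → Set where
  end  : ∀ {y} → y ≤ n → Heights n n y []
  east : ∀ {x y h hs} → x < h → y ≤ h → h ≤ n → Heights n (suc x) h hs → Heights n x y (h ∷ hs)

Heights-cast : ∀ {n x x′ y hs} → x ≡ x′ → Heights n x y hs → Heights n x′ y hs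
Heights-cast refl hs = hs

Heights-length : ∀ {n x y hs} → Heights n x y hs → length hs + x ≡ n
Heights-length (end _)                 = refl
Heights-length {x = x} (east _ _ _ hs) = trans (sym (+-suc _ x)) (Heights-length hs)

Heights-≤ : ∀ {n x y hs} → Heights n x y hs → All (_≤ n) hs
Heights-≤ (end _)           = []
Heights-≤ (east _ _ h≤n hs) = h≤n ∷ Heights-≤ hs

Heights-weaken : ∀ {n x y y′ hs} → y′ ≤ y → Heights n x y hs → Heights n x y′ hs
Heights-weaken y′≤y (end y≤n)            = end (≤-trans y′≤y y≤n)
Heights-weaken y′≤y (east x<h y≤h h≤n hs) = east x<h (≤-trans y′≤y y≤h) h≤n hs

Heights-column : ∀ {n x y hs} → Heights n x y hs → ∀ j → x + j < n → x + j < hAt hs (suc j)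
Heights-column {x = x} (end _)            j       x+j<x = ⊥-elim (m+n≮m x j x+j<x)
Heights-column {x = x} (east x<h _ _ _) zero    _ rewrite +-identityʳ x = x<h
Heights-column {x = x} (east _ _ _ hs)  (suc j) x+j<n rewrite +-suc x j = Heights-column hs j x+j<n

replicate-Heights : ∀ {n x y h T} c → y ≤ h → x + c ≤ h → h ≤ n → Heights n (x + c) h T →
                    Heights n x y (replicate c h ++ T)
replicate-Heights {x = x} zero y≤h _ _ T-h =
  Heights-weaken y≤h (Heights-cast (+-identityʳ x) T-h)
replicate-Heights {x = x} (suc c) y≤h x+c≤h h≤n T-h =
  east (≤-trans (s≤s (m≤m+n x c)) x+c≤h′) y≤h h≤n
       (replicate-Heights c ≤-refl x+c≤h′ h≤n (Heights-cast (+-suc x c) T-h))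
  where
  x+c≤h′ : suc x + c ≤ _
  x+c≤h′ = ≤-trans (≤-reflexive (sym (+-suc x c))) x+c≤h

Heights-split : ∀ c {n x y hs} → Heights n x y hs → x + c ≤ n →
  ∃[ mid ] ∃[ tail ] ∃[ y′ ] hs ≡ mid ++ tail × length mid ≡ c × All (λ h → y ≤ h × h ≤ n) mid
                             × y ≤ y′ × Heights n (x + c) y′ tail
Heights-split zero {x = x} {y} {hs} hs-h _ =
  [] , hs , y , refl , refl , [] , ≤-refl , Heights-cast (sym (+-identityʳ x)) hs-h
Heights-split (suc c) {x = x} (end _) n+c<n =
  ⊥-elim (m+n≮m x c (≤-trans (≤-reflexive (sym (+-suc x c))) n+c<n))
Heights-split (suc c) {x = x} (east {h = h} _ y≤h h≤n rest) x+c≤n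
  with Heights-split c rest (≤-trans (≤-reflexive (sym (+-suc x c))) x+c≤n)
... | mid , tail , y′ , refl , refl , bounds , h≤y′ , tail-h =
  h ∷ mid , tail , y′ , refl , refl ,
  (y≤h , h≤n) ∷ All.map (λ (h≤h′ , h′≤n) → ≤-trans y≤h h≤h′ , h′≤n) bounds ,
  ≤-trans y≤h h≤y′ , Heights-cast (sym (+-suc x c)) tail-h

Heights-lift : ∀ a {k x y R} → Heights k x y R → Heights (a + k) (a + x) (a + y) (map (a +_) R)
Heights-lift a (end y≤k)                      = end (+-monoʳ-≤ a y≤k)
Heights-lift a {x = x} (east x<h y≤h h≤k rest) =
  east (+-monoʳ-< a x<h) (+-monoʳ-≤ a y≤h) (+-monoʳ-≤ a h≤k)
       (Heights-cast (+-suc a x) (Heights-lift a rest))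

Heights-unlift : ∀ a {k x x′ y T} → Heights (a + k) x′ y T → x′ ≡ a + x → a ≤ y →
                 ∃[ R ] T ≡ map (a +_) R × Heights k x (y ∸ a) R
Heights-unlift a {k} (end y≤n) a+k≡a+x _ =
  [] , refl , Heights-cast (+-cancelˡ-≡ a k _ a+k≡a+x) (end (m≤n+o⇒m∸n≤o _ a y≤n))
Heights-unlift a {k} {x} (east {h = h} x′<h y≤h h≤n rest) x′≡ a≤y
  with Heights-unlift a rest (trans (cong suc x′≡) (sym (+-suc a x))) (≤-trans a≤y y≤h)
... | R , refl , R-h =
  h ∸ a ∷ R , cong (_∷ map (a +_) R) (sym (m+[n∸m]≡n a≤h)) ,
  east (m+n≤o⇒m≤o∸n (suc x) (subst (_≤ h) (cong suc (trans x′≡ (+-comm a x))) x′<h))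
       (∸-monoˡ-≤ a y≤h) (m≤n+o⇒m∸n≤o h a h≤n) R-h
  where a≤h = ≤-trans a≤y y≤h

heightsFrom-Heights : ∀ {n} s {x y d} → d + x ≡ y → neverBelow d s ≡ true →
                      countN s + y ≡ n → countE s + x ≡ n →
                      Heights n x y (heightsFrom y s)
heightsFrom-Heights []      {y = y} _ _ N≡ E≡ = Heights-cast (sym E≡) (end (subst (y ≤_) N≡ ≤-refl))
heightsFrom-Heights (N ∷ s) {y = y} d+x≡y below N≡ E≡ =
  Heights-weaken (n≤1+n y) (heightsFrom-Heights s (cong suc d+x≡y) below (trans (+-suc _ y) N≡) E≡)
heightsFrom-Heights (E ∷ s) {x} {y} {suc d} d+x≡y below N≡ E≡ =
  east (subst (suc x ≤_) d+x≡y (s≤s (m≤n+m x d))) ≤-refl (subst (y ≤_) N≡ (m≤n+m y _))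
       (heightsFrom-Heights s (trans (+-suc d x) d+x≡y) below N≡ (trans (+-suc _ x) E≡))

ups : ℕ → List Step → List Step
ups zero    s = s
ups (suc j) s = N ∷ ups j s

pathOf : ℕ → ℕ → List ℕ → List Step
pathOf n y []       = ups (n ∸ y) []
pathOf n y (h ∷ hs) = ups (h ∸ y) (E ∷ pathOf n h hs)

countN-ups : ∀ j s → countN (ups j s) ≡ j + countN s
countN-ups zero    s = refl
countN-ups (suc j) s = cong suc (countN-ups j s)

countE-ups : ∀ j s → countE (ups j s) ≡ countE s
countE-ups zero    s = refl
countE-ups (suc j) s = countE-ups j s

neverBelow-ups : ∀ j d s → neverBelow d (ups j s) ≡ neverBelow (j + d) s
neverBelow-ups zero    d s = refl
neverBelow-ups (suc j) d s = trans (neverBelow-ups j (suc d) s) (cong (λ e → neverBelow e s) (+-suc j d))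

heightsFrom-ups : ∀ j y s → heightsFrom y (ups j s) ≡ heightsFrom (j + y) s
heightsFrom-ups zero    y s = refl
heightsFrom-ups (suc j) y s = trans (heightsFrom-ups j (suc y) s) (cong (λ z → heightsFrom z s) (+-suc j y))

countN-pathOf : ∀ {n x y hs} → Heights n x y hs → countN (pathOf n y hs) + y ≡ n
countN-pathOf {n} {y = y} (end y≤n) =
  trans (cong (_+ y) (trans (countN-ups (n ∸ y) []) (+-identityʳ _))) (m∸n+n≡m y≤n)
countN-pathOf {n} {y = y} (east {h = h} {hs} _ y≤h _ rest) = begin
  countN (ups (h ∸ y) (E ∷ p)) + y  ≡⟨ cong (_+ y) (countN-ups (h ∸ y) (E ∷ p)) ⟩
  h ∸ y + countN p + y              ≡⟨ shuffle (h ∸ y) (countN p) y ⟩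
  countN p + (h ∸ y + y)            ≡⟨ cong (countN p +_) (m∸n+n≡m y≤h) ⟩
  countN p + h                      ≡⟨ countN-pathOf rest ⟩
  n                                 ∎
  where
  open ≡-Reasoning
  p = pathOf n h hs
  shuffle : ∀ d c y → d + c + y ≡ c + (d + y)
  shuffle = solve-∀

countE-pathOf : ∀ n y hs → countE (pathOf n y hs) ≡ length hs
countE-pathOf n y []       = countE-ups (n ∸ y) []
countE-pathOf n y (h ∷ hs) = trans (countE-ups (h ∸ y) _) (cong suc (countE-pathOf n h hs))

neverBelow-pathOf : ∀ {n x y d hs} → Heights n x y hs → d + x ≡ y → neverBelow d (pathOf n y hs) ≡ true
neverBelow-pathOf {n} {y = y} {d} (end _) _ = neverBelow-ups (n ∸ y) d []
neverBelow-pathOf {n} {x} {y} {d} (east {h = h} {hs} x<h y≤h _ rest) d+x≡y = begin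
  neverBelow d (ups (h ∸ y) (E ∷ p))  ≡⟨ neverBelow-ups (h ∸ y) d (E ∷ p) ⟩
  neverBelow (h ∸ y + d) (E ∷ p)      ≡⟨ cong (λ e → neverBelow e (E ∷ p)) height≡ ⟩
  neverBelow (h ∸ suc x) p            ≡⟨ neverBelow-pathOf rest (m∸n+n≡m x<h) ⟩
  true                                ∎
  where
  open ≡-Reasoning
  p = pathOf n h hs
  height≡ : h ∸ y + d ≡ suc (h ∸ suc x)
  height≡ = +-cancelʳ-≡ x _ _ (begin
    h ∸ y + d + x        ≡⟨ +-assoc (h ∸ y) d x ⟩
    h ∸ y + (d + x)      ≡⟨ cong (h ∸ y +_) d+x≡y ⟩
    h ∸ y + y            ≡⟨ m∸n+n≡m y≤h ⟩
    h                    ≡⟨ m∸n+n≡m x<h ⟨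
    h ∸ suc x + suc x    ≡⟨ +-suc (h ∸ suc x) x ⟩
    suc (h ∸ suc x) + x  ∎)

heightsFrom-pathOf : ∀ {n x y hs} → Heights n x y hs → heightsFrom y (pathOf n y hs) ≡ hs
heightsFrom-pathOf {n} {y = y} (end _) = heightsFrom-ups (n ∸ y) y []
heightsFrom-pathOf {n} {y = y} (east {h = h} {hs} _ y≤h _ rest) =
  trans (heightsFrom-ups (h ∸ y) y (E ∷ pathOf n h hs))
        (trans (cong (λ z → z ∷ heightsFrom z (pathOf n h hs)) (m∸n+n≡m y≤h))
               (cong (h ∷_) (heightsFrom-pathOf rest)))

Dyck-Heights : ∀ {n} (π : Dyck n) → Heights n 0 0 (heights (proj₁ π))
Dyck-Heights (s , N≡ , E≡ , below) =
  heightsFrom-Heights s refl below (trans (+-identityʳ _) N≡) (trans (+-identityʳ _) E≡)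

Heights-Dyck : ∀ {n hs} → Heights n 0 0 hs → Σ (Dyck n) λ π → heights (proj₁ π) ≡ hs
Heights-Dyck {n} {hs} hs-h =
  (pathOf n 0 hs ,
   trans (sym (+-identityʳ _)) (countN-pathOf hs-h) ,
   trans (countE-pathOf n 0 hs) (trans (sym (+-identityʳ _)) (Heights-length hs-h)) ,
   neverBelow-pathOf hs-h refl) ,
  heightsFrom-pathOf hs-h

sumFrom : ℕ → ℕ → ℕ
sumFrom j zero    = 0
sumFrom j (suc m) = j + sumFrom (suc j) m

areaFrom-sum : ∀ {n x y hs} → Heights n x y hs → areaFrom (suc x) hs + sumFrom (suc x) (length hs) ≡ sum hs
areaFrom-sum (end _) = refl
areaFrom-sum {x = x} (east {h = h} {hs = hs} x<h _ _ rest) =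
  trans (shuffle (h ∸ suc x) (areaFrom (suc (suc x)) hs) (suc x) (sumFrom (suc (suc x)) (length hs)))
        (cong₂ _+_ (m∸n+n≡m x<h) (areaFrom-sum rest))
  where
  shuffle : ∀ a r j s → a + r + (j + s) ≡ a + j + (r + s)
  shuffle = solve-∀

hAt-++ : ∀ (pre ts : List ℕ) j → hAt (pre ++ ts) (suc (length pre + j)) ≡ hAt ts (suc j)
hAt-++ []        ts j = refl
hAt-++ (_ ∷ pre) ts j = hAt-++ pre ts j

hAt-map : ∀ a (ts : List ℕ) j → j < length ts → hAt (map (a +_) ts) (suc j) ≡ a + hAt ts (suc j)
hAt-map a (_ ∷ ts) zero    _         = refl
hAt-map a (_ ∷ ts) (suc j) (s≤s j<l) = hAt-map a ts j j<l

hAt-≤ : ∀ {k ts} → All (_≤ k) ts → ∀ j → hAt ts j ≤ k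
hAt-≤ []           _             = z≤n
hAt-≤ (_ ∷ _)      zero          = z≤n
hAt-≤ (t≤k ∷ _)    (suc zero)    = t≤k
hAt-≤ (_ ∷ ts≤k)   (suc (suc j)) = hAt-≤ ts≤k (suc j)

bounceFrom-shift : ∀ f a {k} j (pre ts : List ℕ) →
                   length pre ≡ a → length ts ≡ k → All (_≤ k) ts → j ≤ k →
                   bounceFrom f (a + k) (a + j) (pre ++ map (a +_) ts) ≡ bounceFrom f k j ts
bounceFrom-shift zero    a     j pre ts _    _     _   _   = refl
bounceFrom-shift (suc f) a {k} j pre ts refl len≡k ts≤k j≤k with a + j ≟ a + k | j ≟ k
... | yes _  | yes _  = refl
... | yes eq | no j≢k = ⊥-elim (j≢k (+-cancelˡ-≡ a _ _ eq))
... | no ne  | yes eq = ⊥-elim (ne (cong (a +_) eq))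
... | no _   | no j≢k =
  cong₂ _+_ (trans (cong (a + k ∸_) next) ([m+n]∸[m+o]≡n∸o a k _))
            (trans (cong (λ b → bounceFrom f (a + k) b (pre ++ map (a +_) ts)) next)
                   (bounceFrom-shift f a _ pre ts refl len≡k ts≤k (hAt-≤ ts≤k (suc j))))
  where
  next : hAt (pre ++ map (a +_) ts) (suc (a + j)) ≡ a + hAt ts (suc j)
  next = trans (hAt-++ pre _ j) (hAt-map a ts j (subst (j <_) (sym len≡k) (≤∧≢⇒< j≤k j≢k)))

bounceFrom-done : ∀ f k hs → bounceFrom f k k hs ≡ 0
bounceFrom-done zero    k hs = refl
bounceFrom-done (suc f) k hs with k ≟ k
... | yes _  = refl
... | no k≢k = ⊥-elim (k≢k refl)

-- Bounce points strictly increase (Heights-column), so fuel f from bounce point j suffices once k ≤ f + j.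
bounceFrom-fuel : ∀ {k y R} → Heights k 0 y R → ∀ f j → j ≤ k → k ≤ f + j →
                  bounceFrom f k j R ≡ bounceFrom (suc f) k j R
bounceFrom-fuel {k} R-h zero j j≤k k≤j with j ≟ k
... | yes _  = refl
... | no j≢k = ⊥-elim (j≢k (≤-antisym j≤k k≤j))
bounceFrom-fuel {k} {R = R} R-h (suc f) j j≤k k≤f+j with j ≟ k
... | yes _  = refl
... | no j≢k =
  cong (k ∸ hAt R (suc j) +_) (bounceFrom-fuel R-h f _ (hAt-≤ (Heights-≤ R-h) (suc j)) k≤f+next)
  where
  k≤f+next : k ≤ f + hAt R (suc j)
  k≤f+next = ≤-trans k≤f+j (≤-trans (≤-reflexive (sym (+-suc f j)))
                                    (+-monoʳ-≤ f (Heights-column R-h j (≤∧≢⇒< j≤k j≢k))))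

bounceFrom-extraFuel : ∀ {k y R} → Heights k 0 y R → ∀ c → bounceFrom (c + k) k 0 R ≡ bounceFrom k k 0 R
bounceFrom-extraFuel R-h zero        = refl
bounceFrom-extraFuel {k} R-h (suc c) =
  trans (sym (bounceFrom-fuel R-h (c + k) 0 z≤n (≤-trans (m≤n+m k c) (≤-reflexive (sym (+-identityʳ _))))))
        (bounceFrom-extraFuel R-h c)

weight : ℕ → List ℕ → ℕ
weight n hs = sum hs + bounceFrom n n 0 hs

areaBounce-weight : ∀ {n} (π : Dyck n) → area π + bounce π + sumFrom 1 n ≡ weight n (heights (proj₁ π))
areaBounce-weight {n} π@(s , _) = begin
  area π + bounce π + sumFrom 1 n            ≡⟨ shuffle (area π) (bounce π) (sumFrom 1 n) ⟩
  area π + sumFrom 1 n + bounce π            ≡⟨ cong (λ l → area π + sumFrom 1 l + bounce π) (sym length≡n) ⟩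
  area π + sumFrom 1 (length hs) + bounce π  ≡⟨ cong (_+ bounce π) (areaFrom-sum (Dyck-Heights π)) ⟩
  weight n hs                                ∎
  where
  open ≡-Reasoning
  hs = heights s
  length≡n : length hs ≡ n
  length≡n = trans (sym (+-identityʳ _)) (Heights-length (Dyck-Heights π))
  shuffle : ∀ a b s → a + b + s ≡ a + s + b
  shuffle = solve-∀

-- Heights of a path whose first bounce point is suc c: a first column of height suc c, then the
-- columns mid up to the bounce point, then a Dyck path R of semilength k translated by (suc c, suc c).
firstBounce : ℕ → List ℕ → List ℕ → List ℕ
firstBounce c mid R = suc c ∷ mid ++ map (suc c +_) R

sum-map-+ : ∀ a xs → sum (map (a +_) xs) ≡ length xs * a + sum xs
sum-map-+ a []       = refl
sum-map-+ a (x ∷ xs) =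
  trans (cong (a + x +_) (sum-map-+ a xs)) (shuffle a x (length xs * a) (sum xs))
  where
  shuffle : ∀ a x la s → a + x + (la + s) ≡ a + la + (x + s)
  shuffle = solve-∀

sum-replicate : ∀ c a → sum (replicate c a) ≡ c * a
sum-replicate zero    a = refl
sum-replicate (suc c) a = cong (a +_) (sum-replicate c a)

weight-firstBounce : ∀ {c k y mid R} → length mid ≡ c → Heights k 0 y R →
  weight (suc c + k) (firstBounce c mid R) ≡ suc c + sum mid + k * suc c + k + weight k R
weight-firstBounce {c} {k} {mid = mid} {R} refl R-h = begin
  sum (firstBounce c mid R) + bounceFrom (a + k) (a + k) 0 (firstBounce c mid R)
    ≡⟨ cong₂ _+_ sum≡ (cong₂ _+_ (m+n∸m≡n a k) bounce≡) ⟩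
  a + (sum mid + (k * a + sum R)) + (k + bounceFrom k k 0 R)
    ≡⟨ shuffle a (sum mid) (k * a) (sum R) k (bounceFrom k k 0 R) ⟩
  a + sum mid + k * a + k + weight k R
    ∎
  where
  open ≡-Reasoning
  a = suc c
  length-R : length R ≡ k
  length-R = trans (sym (+-identityʳ _)) (Heights-length R-h)
  sum≡ : sum (firstBounce c mid R) ≡ a + (sum mid + (k * a + sum R))
  sum≡ = cong (a +_) (trans (sum-++ mid _) (cong (sum mid +_)
           (trans (sum-map-+ a R) (cong (λ l → l * a + sum R) length-R))))
  bounce≡ : bounceFrom (c + k) (a + k) a (firstBounce c mid R) ≡ bounceFrom k k 0 R
  bounce≡ = begin
    bounceFrom (c + k) (a + k) a (firstBounce c mid R)
      ≡⟨ cong (λ b → bounceFrom (c + k) (a + k) b (firstBounce c mid R)) (sym (+-identityʳ a)) ⟩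
    bounceFrom (c + k) (a + k) (a + 0) ((a ∷ mid) ++ map (a +_) R)
      ≡⟨ bounceFrom-shift (c + k) a 0 (a ∷ mid) R refl length-R (Heights-≤ R-h) z≤n ⟩
    bounceFrom (c + k) k 0 R
      ≡⟨ bounceFrom-extraFuel R-h c ⟩
    bounceFrom k k 0 R
      ∎
  shuffle : ∀ a s ka r k b → a + (s + (ka + r)) + (k + b) ≡ a + s + ka + k + (r + b)
  shuffle = solve-∀

square-firstBounce : ∀ c k →
  (suc c + k) * (suc c + k) ≡ suc c + c * (suc c + k) + k * suc c + k + k * k
square-firstBounce = solve-∀

weight-firstBounce-deficit : ∀ {c k y z mid R} → length mid ≡ c → Heights k 0 y R →
  sum mid + z ≡ c * (suc c + k) →
  weight (suc c + k) (firstBounce c mid R) + z + k * k ≡ (suc c + k) * (suc c + k) + weight k R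
weight-firstBounce-deficit {c} {k} {z = z} {mid} {R} length-mid R-h deficit = begin
  weight (a + k) (firstBounce c mid R) + z + k * k
    ≡⟨ cong (λ w → w + z + k * k) (weight-firstBounce length-mid R-h) ⟩
  a + sum mid + k * a + k + weight k R + z + k * k
    ≡⟨ shuffle a (sum mid) (k * a) k (weight k R) z (k * k) ⟩
  a + (sum mid + z) + k * a + k + k * k + weight k R
    ≡⟨ cong (λ s → a + s + k * a + k + k * k + weight k R) deficit ⟩
  a + c * (a + k) + k * a + k + k * k + weight k R
    ≡⟨ cong (_+ weight k R) (sym (square-firstBounce c k)) ⟩
  (a + k) * (a + k) + weight k R
    ∎
  where
  open ≡-Reasoning
  a = suc c
  shuffle : ∀ a s ka k w z kk → a + s + ka + k + w + z + kk ≡ a + (s + z) + ka + k + kk + w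
  shuffle = solve-∀

sum-deficit : ∀ {a k} xs → All (λ h → a ≤ h × h ≤ a + k) xs →
              ∃[ z ] z ≤ length xs * k × sum xs + z ≡ length xs * (a + k)
sum-deficit []       []                          = 0 , z≤n , refl
sum-deficit {a} {k} (h ∷ xs) ((a≤h , h≤a+k) ∷ bounds) with sum-deficit xs bounds
... | z , z≤ , deficit =
  a + k ∸ h + z , +-mono-≤ (m≤n+o⇒m∸n≤o (a + k) h (+-monoˡ-≤ k a≤h)) z≤ ,
  trans (shuffle h (sum xs) (a + k ∸ h) z)
        (cong₂ _+_ (m+[n∸m]≡n h≤a+k) deficit)
  where
  shuffle : ∀ h s d z → h + s + (d + z) ≡ h + d + (s + z)
  shuffle = solve-∀

weight-decompose : ∀ {m hs} → Heights (suc m) 0 0 hs →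
  ∃[ c ] ∃[ k ] ∃[ R ] ∃[ z ] c + k ≡ m × z ≤ c * k × Heights k 0 0 R
                            × weight (suc m) hs + z + k * k ≡ suc m * suc m + weight k R
weight-decompose (east {h = suc c} _ _ (s≤s c≤m) rest) with m≤n⇒∃[o]m+o≡n c≤m
... | k , refl with Heights-split c rest (s≤s (m≤m+n c k))
... | mid , tail , y′ , refl , length-mid , bounds , c<y′ , tail-h
      with Heights-unlift (suc c) tail-h (sym (+-identityʳ (suc c))) c<y′
... | R , refl , R-h with sum-deficit mid bounds
... | z , z≤ , deficit =
  c , k , R , z , refl , subst (λ l → z ≤ l * k) length-mid z≤ , Heights-weaken z≤n R-h ,
  weight-firstBounce-deficit length-mid R-h
    (subst (λ l → sum mid + z ≡ l * suc (c + k)) length-mid deficit)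

combine-gaps : ∀ w z {x r s t} → w + z + s ≡ t + r → r + x ≡ s → w + (z + x) ≡ t
combine-gaps w z {x} {r} {s} {t} w+z+s≡t+r r+x≡s = +-cancelʳ-≡ r _ _ (begin
  w + (z + x) + r  ≡⟨ shuffle w z x r ⟩
  w + z + (r + x)  ≡⟨ cong (w + z +_) r+x≡s ⟩
  w + z + s        ≡⟨ w+z+s≡t+r ⟩
  t + r            ∎)
  where
  open ≡-Reasoning
  shuffle : ∀ w z x r → w + (z + x) + r ≡ w + z + (r + x)
  shuffle = solve-∀

weight-gap : ∀ n {hs} → Heights n 0 0 hs → ∃[ x ] x < D n × weight n hs + x ≡ n * n
weight-gap = <-rec (λ n → ∀ {hs} → Heights n 0 0 hs → ∃[ x ] x < D n × weight n hs + x ≡ n * n) step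
  where
  step : ∀ n → (∀ {k} → k < n → ∀ {hs} → Heights k 0 0 hs → ∃[ x ] x < D k × weight k hs + x ≡ k * k) →
         ∀ {hs} → Heights n 0 0 hs → ∃[ x ] x < D n × weight n hs + x ≡ n * n
  step zero    _   (end _)               = 0 , D-pos 0 , refl
  step zero    _   (east (s≤s _) _ () _)
  step (suc m) rec {hs} hs-h with weight-decompose hs-h
  ... | c , k , R , z , refl , z≤ , R-h , split with rec (s≤s (m≤n+m k c)) R-h
  ... | x , x< , gap-R = z + x , ≤-trans (+-mono-≤-< z≤ x<) (D-suc-≥ c k) ,
    combine-gaps (weight (suc m) hs) z split gap-R

-- c nondecreasing heights whose deficits below n are k, …, k, r, 0, …, 0 (greedily), summing to x.
greedyHeights : ℕ → ℕ → ℕ → ℕ → List ℕ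
greedyHeights n k x zero    = []
greedyHeights n k x (suc c) = n ∸ (k ⊓ x) ∷ greedyHeights n k (x ∸ k) c

greedy-length : ∀ n k x c → length (greedyHeights n k x c) ≡ c
greedy-length n k x zero    = refl
greedy-length n k x (suc c) = cong suc (greedy-length n k (x ∸ k) c)

greedy-sum : ∀ {n k} x c → k ≤ n → x ≤ c * k → sum (greedyHeights n k x c) + x ≡ c * n
greedy-sum         x zero    _   x≤0 = n≤0⇒n≡0 x≤0
greedy-sum {n} {k} x (suc c) k≤n x≤ = begin
  n ∸ (k ⊓ x) + sum rest + x
    ≡⟨ cong (n ∸ (k ⊓ x) + sum rest +_) (sym (m⊓n+n∸m≡n k x)) ⟩
  n ∸ (k ⊓ x) + sum rest + (k ⊓ x + (x ∸ k))
    ≡⟨ shuffle (n ∸ (k ⊓ x)) (sum rest) (k ⊓ x) (x ∸ k) ⟩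
  (n ∸ (k ⊓ x) + k ⊓ x) + (sum rest + (x ∸ k))
    ≡⟨ cong₂ _+_ (m∸n+n≡m (≤-trans (m⊓n≤m k x) k≤n)) (greedy-sum (x ∸ k) c k≤n (m≤n+o⇒m∸n≤o x k x≤)) ⟩
  n + c * n
    ∎
  where
  open ≡-Reasoning
  rest = greedyHeights n k (x ∸ k) c
  shuffle : ∀ a s m r → a + s + (m + r) ≡ a + m + (s + r)
  shuffle = solve-∀

greedy-Heights : ∀ {n k} x c {i y} → y ≤ n ∸ (k ⊓ x) → i + (c + k) ≡ n →
                 Heights n i y (greedyHeights n k x c ++ replicate k n)
greedy-Heights {n} {k} x zero {i} y≤ i+k≡n =
  subst (Heights n i _) (++-identityʳ _)
        (replicate-Heights k (≤-trans y≤ (m∸n≤m n (k ⊓ x))) (≤-reflexive i+k≡n) ≤-refl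
                           (Heights-cast (sym i+k≡n) (end ≤-refl)))
greedy-Heights {n} {k} x (suc c) {i} y≤ i+c+k≡n =
  east i<h y≤ (m∸n≤m n (k ⊓ x))
       (greedy-Heights (x ∸ k) c (∸-monoʳ-≤ n (⊓-monoʳ-≤ k (m∸n≤m x k)))
                       (trans (sym (+-suc i (c + k))) i+c+k≡n))
  where
  i<h : i < n ∸ (k ⊓ x)
  i<h = m+n≤o⇒m≤o∸n (suc i) (begin
    suc i + k ⊓ x      ≤⟨ +-monoʳ-≤ (suc i) (m⊓n≤m k x) ⟩
    suc (i + k)        ≤⟨ s≤s (+-monoʳ-≤ i (m≤n+m k c)) ⟩
    suc (i + (c + k))  ≡⟨ sym (+-suc i (c + k)) ⟩
    i + suc (c + k)    ≡⟨ i+c+k≡n ⟩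
    n                  ∎)
    where open ≤-Reasoning

highest-Heights : ∀ k → Heights k 0 0 (replicate k k)
highest-Heights k =
  subst (Heights k 0 0) (++-identityʳ _) (replicate-Heights k z≤n ≤-refl ≤-refl (end ≤-refl))

weight-replicate : ∀ k → weight k (replicate k k) ≡ k * k
weight-replicate zero    = refl
weight-replicate (suc k) =
  trans (cong₂ _+_ (sum-replicate (suc k) (suc k)) (cong₂ _+_ (n∸n≡0 k) (bounceFrom-done k (suc k) _)))
        (+-identityʳ _)

minimal-firstBounce : ∀ c k {R} → Heights k 0 0 R →
  ∃[ hs ] Heights (suc c + k) 0 0 hs
        × weight (suc c + k) hs + c * k + k * k ≡ (suc c + k) * (suc c + k) + weight k R
minimal-firstBounce c k {R} R-h =
  firstBounce c (replicate c a) R ,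
  east (s≤s z≤n) z≤n a≤n (replicate-Heights c ≤-refl ≤-refl a≤n lifted) ,
  weight-firstBounce-deficit (length-replicate c) R-h
    (trans (cong (_+ c * k) (sum-replicate c a)) (sym (*-distribˡ-+ c a k)))
  where
  a = suc c
  a≤n : a ≤ a + k
  a≤n = m≤m+n a k
  lifted : Heights (a + k) a a (map (a +_) R)
  lifted = Heights-weaken (m≤m+n a 0) (Heights-cast (+-identityʳ a) (Heights-lift a R-h))

filled-firstBounce : ∀ c k {x} → x ≤ c * k →
  ∃[ hs ] Heights (suc c + k) 0 0 hs × weight (suc c + k) hs + x ≡ (suc c + k) * (suc c + k)
filled-firstBounce c k {x} x≤ck =
  firstBounce c mid (replicate k k) ,
  east (s≤s z≤n) z≤n (m≤m+n a k)
       (subst (λ t → Heights n 1 a (mid ++ t)) (sym (map-replicate (a +_) k k))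
              (greedy-Heights x c a≤ refl)) ,
  +-cancelʳ-≡ (k * k) _ _
    (trans (weight-firstBounce-deficit (greedy-length n k x c) (highest-Heights k)
                                       (greedy-sum x c (m≤n+m k a) x≤ck))
           (cong (n * n +_) (weight-replicate k)))
  where
  a = suc c
  n = a + k
  mid = greedyHeights n k x c
  a≤ : a ≤ n ∸ (k ⊓ x)
  a≤ = ≤-trans (≤-reflexive (sym (m+n∸n≡m a k))) (∸-monoʳ-≤ n (m⊓n≤m k x))

gap-realised : ∀ n {x} → x < D n → ∃[ hs ] Heights n 0 0 hs × weight n hs + x ≡ n * n
gap-realised = <-rec (λ n → ∀ {x} → x < D n → ∃[ hs ] Heights n 0 0 hs × weight n hs + x ≡ n * n) step
  where
  step : ∀ n → (∀ {k} → k < n → ∀ {x} → x < D k → ∃[ hs ] Heights k 0 0 hs × weight k hs + x ≡ k * k) →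
         ∀ {x} → x < D n → ∃[ hs ] Heights n 0 0 hs × weight n hs + x ≡ n * n
  step zero    _   (s≤s z≤n) = [] , end z≤n , refl
  step (suc m) rec {x} x<D with D-suc-attained m
  ... | c , k , refl , D≡ with c * k ≤? x
  ...   | no  ck≰x = filled-firstBounce c k (<⇒≤ (≰⇒> ck≰x))
  ...   | yes ck≤x
          with rec (s≤s (m≤n+m k c)) (m<n+o⇒m∸n<o x (c * k) {{>-nonZero (D-pos k)}} (subst (x <_) D≡ x<D))
  ...     | R , R-h , gap-R with minimal-firstBounce c k R-h
  ...       | hs , hs-h , split =
    hs , hs-h ,
    trans (cong (weight n hs +_) (sym (m+[n∸m]≡n ck≤x))) (combine-gaps (weight n hs) (c * k) split gap-R)
    where n = suc (c + k)

Dyck-gap : ∀ {n} (π : Dyck n) → ∃[ x ] x < D n × area π + bounce π + sumFrom 1 n + x ≡ n * n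
Dyck-gap {n} π with weight-gap n (Dyck-Heights π)
... | x , x<D , gap = x , x<D , trans (cong (_+ x) (areaBounce-weight π)) gap

gap-Dyck : ∀ n {x} → x < D n → Σ (Dyck n) λ π → area π + bounce π + sumFrom 1 n + x ≡ n * n
gap-Dyck n {x} x<D with gap-realised n x<D
... | hs , hs-h , gap with Heights-Dyck hs-h
...   | π , refl = π , trans (cong (_+ x) (areaBounce-weight π)) gap

values-by-gap : ∀ {P : ℕ → Set} s t d →
  (∀ x → x < d → ∃[ k ] P k × k + s + x ≡ t) → (∀ k → P k → ∃[ x ] x < d × k + s + x ≡ t) →
  ∃[ L ] (Unique L × (∀ k → k ∈ L ⇔ P k) × length L ≡ d)
values-by-gap {P} s t d realise attained =
  List.tabulate value , tabulate⁺ value-injective , (λ k → mk⇔ (sound k) (complete k)) ,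
  length-tabulate value
  where
  value : Fin d → ℕ
  value i = proj₁ (realise (toℕ i) (toℕ<n i))
  gap : ∀ i → value i + s + toℕ i ≡ t
  gap i = proj₂ (proj₂ (realise (toℕ i) (toℕ<n i)))
  value-injective : ∀ {i j} → value i ≡ value j → i ≡ j
  value-injective {i} {j} vi≡vj = toℕ-injective (+-cancelˡ-≡ (value i + s) _ _ (begin
    value i + s + toℕ i  ≡⟨ gap i ⟩
    t                    ≡⟨ gap j ⟨
    value j + s + toℕ j  ≡⟨ cong (λ v → v + s + toℕ j) vi≡vj ⟨
    value i + s + toℕ j  ∎))
    where open ≡-Reasoning
  sound : ∀ k → k ∈ List.tabulate value → P k
  sound k k∈ with ∈-tabulate⁻ k∈
  ... | i , refl = proj₁ (proj₂ (realise (toℕ i) (toℕ<n i)))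
  complete : ∀ k → P k → k ∈ List.tabulate value
  complete k Pk with attained k Pk
  ... | x , x<d , gap-k = subst (_∈ List.tabulate value) value≡k (∈-tabulate⁺ i)
    where
    i = fromℕ< x<d
    value≡k : value i ≡ k
    value≡k = +-cancelʳ-≡ s _ _ (+-cancelʳ-≡ x _ _
                (trans (cong (value i + s +_) (sym (toℕ-fromℕ< x<d))) (trans (gap i) (sym gap-k))))

theorem5p1 : (n : ℕ) →
    ∃[ L ] (Unique L
           × ((k : ℕ) → (k ∈ L) ⇔ (∃[ π ] (area {n} π + bounce {n} π ≡ k)))
           × (length L ≡ nonzeroCoeffs (qBell n)))
theorem5p1 n = values-by-gap (sumFrom 1 n) (n * n) (D n) realise attained
  where
  realise : ∀ x → x < D n → ∃[ k ] (∃[ π ] area {n} π + bounce {n} π ≡ k) × k + sumFrom 1 n + x ≡ n * n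
  realise x x<D with gap-Dyck n x<D
  ... | π , gap = area π + bounce π , (π , refl) , gap
  attained : ∀ k → (∃[ π ] area {n} π + bounce {n} π ≡ k) → ∃[ x ] x < D n × k + sumFrom 1 n + x ≡ n * n
  attained k (π , refl) = Dyck-gap π
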